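{- Let $n\in\mathbb{N}$ and let $G=(V,E)$ be a $d$-regular graph with $V\subseteq\mathcal{P}([n])$, let $\varepsilon\ge0$ and $F\in\mathcal{F}_V$. Suppose that for every $i\in[n]$ the subgraph of $G$ induced on $V_i=\{S\in V: i\in S\}$ is a clique (with self-loops), and that there is a constant $c>0$ such that for every $S\in V$ and every $i\in S$, a uniformly random neighbor $S'$ of $S$ in $G$ contains $i$ with probability at least $c$. If $F$ passes the test $\mathcal{T}(G)$ with probability $1-\varepsilon$, then $F$ is $(1-\frac{2\varepsilon}{c})$-close to $\mathrm{dec}(F)$.
   Context: For $V\subseteq\mathcal{P}([n])$, $\mathcal{F}_V$ is the set of all maps $F$ assigning to each $S\in V$ a function $F(S)\in\{0,1\}^S$. For $a\in\{0,1\}^n$, $\mathrm{DP}_V(a)(S)=a|_S$. For $F,H\in\mathcal{F}_V$, $\Delta(F,H)=|\{S\in V:F(S)\neq H(S)\}|/|V|$, and $F$ is $(1-\delta)$-close to $H$ if $\Delta(F,H)\le\delta$. For $F\in\mathcal{F}_V$, $a^F_i$ is the majority value of $F(S)_i$ over $S\in V$ with $i\in S$, and $\mathrm{dec}(F)=\mathrm{DP}_V(a^F)$. The test $\mathcal{T}(G)$ picks an edge $(S,S')$ of $G$ uniformly at random and accepts iff $F(S)|_{S\cap S'}=F(S')|_{S\cap S'}$.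
   Formalization: The constant c in the hypothesis that a uniformly random neighbour of S contains i with probability at least c ranges over the positive rationals. -}

module Defs where

open import Data.Bool using (Bool; true; false; _∧_; _∨_; not; if_then_else_)
import Data.Bool as B
open import Data.Nat using (ℕ; zero; suc; _+_; _*_; NonZero)
open import Data.Nat.Properties using (m*n≢0)
open import Data.Fin using (Fin)
import Data.Fin as Fin
open import Data.Fin.Subset using (Subset; _∈_; _∩_)
open import Data.Fin.Subset.Properties using (_∈?_)
open import Data.Integer using (+_)
open import Data.Rational using (ℚ; _/_)
open import Relation.Nullary using (does)
open import Relation.Binary.PropositionalEquality using (_≡_)

count : ∀ {k} → (Fin k → Bool) → ℕ
count {zero}  p = 0
count {suc k} p = (if p Fin.zero then 1 else 0) + count (λ x → p (Fin.suc x))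

sumF : ∀ {k} → (Fin k → ℕ) → ℕ
sumF {zero}  f = 0
sumF {suc k} f = f Fin.zero + sumF (λ x → f (Fin.suc x))

allB : ∀ {n} → (Fin n → Bool) → Bool
allB {zero}  p = true
allB {suc n} p = p Fin.zero ∧ allB (λ x → p (Fin.suc x))

_==_ : Bool → Bool → Bool
a == b = does (a B.≟ b)

-- The vertex set V ⊆ P([n]) with |V| = m is given as an (injective)
-- enumeration  V : Fin m → Subset n.  An element F(S) ∈ {0,1}^S is
-- represented by a function Fin n → Bool of which only the values on S
-- are ever inspected.  So F ∈ 𝓕_V is  F : Fin m → (Fin n → Bool).
Assignment : ℕ → ℕ → Set
Assignment m n = Fin m → Fin n → Bool

agreeOn : ∀ {n} → Subset n → (Fin n → Bool) → (Fin n → Bool) → Bool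
agreeOn T f g = allB (λ i → not (does (i ∈? T)) ∨ (f i == g i))

DP : ∀ {m n} → (Fin m → Subset n) → (Fin n → Bool) → Assignment m n
DP V a = λ _ i → a i

Δ : ∀ {m n} .{{_ : NonZero m}} → (Fin m → Subset n) →
    Assignment m n → Assignment m n → ℚ
Δ {m} V F H = (+ count (λ v → not (agreeOn (V v) (F v) (H v)))) / m

IsMajority : ∀ {m n} → (Fin m → Subset n) → Assignment m n → (Fin n → Bool) → Set
IsMajority {m} {n} V F a = ∀ (i : Fin n) →
  count (λ v → does (i ∈? V v) ∧ not (F v i == a i))
    Data.Nat.≤ count (λ v → does (i ∈? V v) ∧ (F v i == a i))

IsUndirected : ∀ {m} → (Fin m → Fin m → Bool) → Set
IsUndirected {m} Adj = ∀ (u v : Fin m) → Adj u v ≡ Adj v u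

-- d-regular: every vertex has exactly d neighbours (a self-loop counts once).
IsRegular : ∀ {m} → (Fin m → Fin m → Bool) → ℕ → Set
IsRegular {m} Adj d = ∀ (u : Fin m) → count (Adj u) ≡ d

InducedCliques : ∀ {m n} → (Fin m → Subset n) → (Fin m → Fin m → Bool) → Set
InducedCliques {m} {n} V Adj =
  ∀ (i : Fin n) (u v : Fin m) → i ∈ V u → i ∈ V v → Adj u v ≡ true

neighbourProb : ∀ {m n} → (Fin m → Subset n) → (Fin m → Fin m → Bool) →
                (d : ℕ) .{{_ : NonZero d}} → Fin m → Fin n → ℚ
neighbourProb V Adj d u i = (+ count (λ v → Adj u v ∧ does (i ∈? V v))) / d

-- Acceptance probability of the test 𝓣(G): a uniformly random edge (S,S'),
-- taken as a uniformly random ordered adjacent pair (equivalently a uniform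
-- vertex followed by a uniform neighbour; there are m·d such pairs), is
-- accepted iff F(S)|_{S∩S'} = F(S')|_{S∩S'}.
acceptProb : ∀ {m n} → (Fin m → Subset n) → (Fin m → Fin m → Bool) →
             (d : ℕ) .{{_ : NonZero m}} .{{_ : NonZero d}} → Assignment m n → ℚ
acceptProb {m} V Adj d F =
  _/_ (+ sumF (λ u → count (λ v → Adj u v ∧ agreeOn (V u ∩ V v) (F u) (F v))))
      (m * d) {{m*n≢0 m d}}

-- If S disagrees with the majority word a, pick i ∈ S with F(S)_i ≠ a_i. Every
-- neighbour S' ∋ i with F(S')_i = a_i is adjacent to S (V_i is a clique) and
-- rejects the edge; by majority these are at least half of V_i, which contains
-- at least c·d neighbours of S. So each disagreeing vertex carries c·d/2
-- rejected edges, and summing over vertices gives c·d·|bad| ≤ 2·ε·|V|·d.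
module Submission where

open import Defs
open import Data.Bool using (Bool; true; false; T; _∧_; not)
open import Data.Bool.Properties using (T-∧) renaming (_≟_ to _≟ᵇ_)
open import Data.Empty using (⊥-elim)
open import Data.Fin using (Fin; zero; suc)
open import Data.Fin.Subset using (Subset; _∈_; _∩_)
open import Data.Fin.Subset.Properties using (_∈?_; x∈p∩q⁺)
open import Data.Integer as ℤ using (+_; +≤+)
import Data.Integer.Properties as ℤₚ
open import Data.Nat as ℕ using (ℕ; NonZero; z≤n; s≤s)
import Data.Nat.Properties as ℕₚ
open import Algebra.Properties.CommutativeSemigroup ℕₚ.+-commutativeSemigroup
  using () renaming (interchange to +-interchange)
open import Data.Product using (∃-syntax; _×_; _,_; proj₁; proj₂)
open import Data.Rational
  using (ℚ; 0ℚ; 1ℚ; _≤_; _>_; _+_; _-_; _*_; _÷_; 1/_; _/_; >-nonZero;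
         positive; nonNegative; Positive; NonNegative; toℚᵘ)
open import Data.Rational.Properties
open import Data.Rational.Solver using (module +-*-Solver)
import Data.Rational.Unnormalised as ℚᵘ
import Data.Rational.Unnormalised.Properties as ℚᵘₚ
open import Data.Unit using (tt)
open import Function using (_∘_)
open import Function.Bundles using (Equivalence)
open import Function.Definitions using (Injective)
open import Relation.Nullary using (Dec; yes; no; does; ¬_; contradiction)
open import Relation.Binary.PropositionalEquality

fromℕ : ℕ → ℚ
fromℕ a = + a / 1

toℚᵘ-/ : ∀ a k → toℚᵘ (+ a / ℕ.suc k) ℚᵘ.≃ ℚᵘ.mkℚᵘ (+ a) k
toℚᵘ-/ a k = toℚᵘ-fromℚᵘ (ℚᵘ.mkℚᵘ (+ a) k)

fromℕ-+ : ∀ a b → fromℕ (a ℕ.+ b) ≡ fromℕ a + fromℕ b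
fromℕ-+ a b = toℚᵘ-injective (begin
  toℚᵘ (fromℕ (a ℕ.+ b))                    ≈⟨ toℚᵘ-/ (a ℕ.+ b) 0 ⟩
  ℚᵘ.mkℚᵘ (+ (a ℕ.+ b)) 0                   ≈⟨ ℚᵘ.*≡* (cong (ℤ._* + 1) (trans (ℤₚ.pos-+ a b)
                                                  (sym (cong₂ ℤ._+_ (ℤₚ.*-identityʳ (+ a)) (ℤₚ.*-identityʳ (+ b)))))) ⟩
  ℚᵘ.mkℚᵘ (+ a) 0 ℚᵘ.+ ℚᵘ.mkℚᵘ (+ b) 0      ≈⟨ ℚᵘₚ.+-cong (toℚᵘ-/ a 0) (toℚᵘ-/ b 0) ⟨
  toℚᵘ (fromℕ a) ℚᵘ.+ toℚᵘ (fromℕ b)        ≈⟨ toℚᵘ-homo-+ (fromℕ a) (fromℕ b) ⟨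
  toℚᵘ (fromℕ a + fromℕ b)                  ∎)
  where open ℚᵘₚ.≃-Reasoning

fromℕ-* : ∀ a b → fromℕ (a ℕ.* b) ≡ fromℕ a * fromℕ b
fromℕ-* a b = toℚᵘ-injective (begin
  toℚᵘ (fromℕ (a ℕ.* b))                    ≈⟨ toℚᵘ-/ (a ℕ.* b) 0 ⟩
  ℚᵘ.mkℚᵘ (+ (a ℕ.* b)) 0                   ≈⟨ ℚᵘ.*≡* (cong (ℤ._* + 1) (ℤₚ.pos-* a b)) ⟩
  ℚᵘ.mkℚᵘ (+ a) 0 ℚᵘ.* ℚᵘ.mkℚᵘ (+ b) 0      ≈⟨ ℚᵘₚ.*-cong (toℚᵘ-/ a 0) (toℚᵘ-/ b 0) ⟨
  toℚᵘ (fromℕ a) ℚᵘ.* toℚᵘ (fromℕ b)        ≈⟨ toℚᵘ-homo-* (fromℕ a) (fromℕ b) ⟨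
  toℚᵘ (fromℕ a * fromℕ b)                  ∎)
  where open ℚᵘₚ.≃-Reasoning

fromℕ-mono-≤ : ∀ {a b} → a ℕ.≤ b → fromℕ a ≤ fromℕ b
fromℕ-mono-≤ {a} {b} a≤b = toℚᵘ-cancel-≤ (begin
  toℚᵘ (fromℕ a)    ≃⟨ toℚᵘ-/ a 0 ⟩
  ℚᵘ.mkℚᵘ (+ a) 0   ≤⟨ ℚᵘ.*≤* (ℤₚ.*-monoʳ-≤-nonNeg (+ 1) (+≤+ a≤b)) ⟩
  ℚᵘ.mkℚᵘ (+ b) 0   ≃⟨ toℚᵘ-/ b 0 ⟨
  toℚᵘ (fromℕ b)    ∎)
  where open ℚᵘₚ.≤-Reasoning

fromℕ-nonNeg : ∀ a → NonNegative (fromℕ a)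
fromℕ-nonNeg a = nonNegative (fromℕ-mono-≤ {0} {a} z≤n)

fromℕ-pos : ∀ a .{{_ : NonZero a}} → Positive (fromℕ a)
fromℕ-pos (ℕ.suc a) = positive (<-≤-trans (positive⁻¹ 1ℚ) (fromℕ-mono-≤ {1} {ℕ.suc a} (s≤s z≤n)))

n/d*d≡n : ∀ n d .{{_ : NonZero d}} → (+ n / d) * fromℕ d ≡ fromℕ n
n/d*d≡n n (ℕ.suc k) = toℚᵘ-injective (begin
  toℚᵘ ((+ n / ℕ.suc k) * fromℕ (ℕ.suc k))               ≈⟨ toℚᵘ-homo-* (+ n / ℕ.suc k) (fromℕ (ℕ.suc k)) ⟩
  toℚᵘ (+ n / ℕ.suc k) ℚᵘ.* toℚᵘ (fromℕ (ℕ.suc k))       ≈⟨ ℚᵘₚ.*-cong (toℚᵘ-/ n k) (toℚᵘ-/ (ℕ.suc k) 0) ⟩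
  ℚᵘ.mkℚᵘ (+ n) k ℚᵘ.* ℚᵘ.mkℚᵘ (+ ℕ.suc k) 0             ≈⟨ ℚᵘ.*≡* (trans (ℤₚ.*-identityʳ _)
                                                                   (cong (λ j → + n ℤ.* + ℕ.suc j) (sym (ℕₚ.*-identityʳ k)))) ⟩
  ℚᵘ.mkℚᵘ (+ n) 0                                         ≈⟨ toℚᵘ-/ n 0 ⟨
  toℚᵘ (fromℕ n)                                          ∎)
  where open ℚᵘₚ.≃-Reasoning

*≤⇒≤÷ : ∀ {x y c} (c>0 : c > 0ℚ) → x * c ≤ y → x ≤ _÷_ y c {{>-nonZero c>0}}
*≤⇒≤÷ {x} {y} {c} c>0 xc≤y = *-cancelʳ-≤-pos c {{positive c>0}} (begin
  x * c               ≤⟨ xc≤y ⟩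
  y                   ≡⟨ *-identityʳ y ⟨
  y * 1ℚ              ≡⟨ cong (y *_) (*-inverseˡ c) ⟨
  y * (1/ c * c)      ≡⟨ *-assoc y (1/ c) c ⟨
  y * 1/ c * c        ∎)
  where
  open ≤-Reasoning
  instance _ = >-nonZero c>0

does-sound : ∀ {P : Set} (P? : Dec P) → T (does P?) → P
does-sound (yes p) _ = p

does-complete : ∀ {P : Set} (P? : Dec P) → P → T (does P?)
does-complete (yes _) _ = tt
does-complete (no ¬p) p = ¬p p

T-not⇒¬T : ∀ {b} → T (not b) → ¬ T b
T-not⇒¬T {false} _ ()

count-split : ∀ {k} (p q : Fin k → Bool) →
  count (λ v → p v ∧ q v) ℕ.+ count (λ v → p v ∧ not (q v)) ≡ count p
count-split {ℕ.zero}  p q = refl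
count-split {ℕ.suc k} p q with p zero | q zero
... | false | _     = count-split (p ∘ suc) (q ∘ suc)
... | true  | true  = cong ℕ.suc (count-split (p ∘ suc) (q ∘ suc))
... | true  | false = trans (ℕₚ.+-suc _ _) (cong ℕ.suc (count-split (p ∘ suc) (q ∘ suc)))

count-mono : ∀ {k} (p q : Fin k → Bool) → (∀ v → T (p v) → T (q v)) → count p ℕ.≤ count q
count-mono {ℕ.zero}  p q p⇒q = z≤n
count-mono {ℕ.suc k} p q p⇒q with p zero | q zero | p⇒q zero
... | false | false | _    = count-mono (p ∘ suc) (q ∘ suc) (p⇒q ∘ suc)
... | false | true  | _    = ℕₚ.m≤n⇒m≤1+n (count-mono (p ∘ suc) (q ∘ suc) (p⇒q ∘ suc))
... | true  | true  | _    = s≤s (count-mono (p ∘ suc) (q ∘ suc) (p⇒q ∘ suc))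
... | true  | false | p⇒q₀ = ⊥-elim (p⇒q₀ tt)

sumF-+ : ∀ {k} (f g : Fin k → ℕ) → sumF (λ u → f u ℕ.+ g u) ≡ sumF f ℕ.+ sumF g
sumF-+ {ℕ.zero}  f g = refl
sumF-+ {ℕ.suc k} f g = begin
  f zero ℕ.+ g zero ℕ.+ sumF (λ u → f (suc u) ℕ.+ g (suc u))
    ≡⟨ cong (f zero ℕ.+ g zero ℕ.+_) (sumF-+ (f ∘ suc) (g ∘ suc)) ⟩
  f zero ℕ.+ g zero ℕ.+ (sumF (f ∘ suc) ℕ.+ sumF (g ∘ suc))
    ≡⟨ +-interchange (f zero) (g zero) _ _ ⟩
  f zero ℕ.+ sumF (f ∘ suc) ℕ.+ (g zero ℕ.+ sumF (g ∘ suc))   ∎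
  where open ≡-Reasoning

sumF-const : ∀ {k} (f : Fin k → ℕ) d → (∀ u → f u ≡ d) → sumF f ≡ k ℕ.* d
sumF-const {ℕ.zero}  f d f≡d = refl
sumF-const {ℕ.suc k} f d f≡d = cong₂ ℕ._+_ (f≡d zero) (sumF-const (f ∘ suc) d (f≡d ∘ suc))

*-distribˡ-sumF : ∀ {k} c (f : Fin k → ℕ) → sumF (λ u → c ℕ.* f u) ≡ c ℕ.* sumF f
*-distribˡ-sumF {ℕ.zero}  c f = sym (ℕₚ.*-zeroʳ c)
*-distribˡ-sumF {ℕ.suc k} c f = trans (cong (c ℕ.* f zero ℕ.+_) (*-distribˡ-sumF c (f ∘ suc)))
                                      (sym (ℕₚ.*-distribˡ-+ c (f zero) _))

*-count≤sumF : ∀ {k} (p : Fin k → Bool) (r : Fin k → ℕ) x →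
  (∀ u → T (p u) → x ≤ fromℕ (r u)) → x * fromℕ (count p) ≤ fromℕ (sumF r)
*-count≤sumF {ℕ.zero}  p r x bound = ≤-reflexive (*-zeroʳ x)
*-count≤sumF {ℕ.suc k} p r x bound with p zero | bound zero
... | false | _ = begin
  x * fromℕ (count (p ∘ suc))      ≤⟨ *-count≤sumF (p ∘ suc) (r ∘ suc) x (bound ∘ suc) ⟩
  fromℕ (sumF (r ∘ suc))           ≤⟨ fromℕ-mono-≤ (ℕₚ.m≤n+m _ (r zero)) ⟩
  fromℕ (sumF r)                   ∎
  where open ≤-Reasoning
... | true | x≤r₀ = begin
  x * fromℕ (ℕ.suc (count (p ∘ suc)))                  ≡⟨ cong (x *_) (fromℕ-+ 1 (count (p ∘ suc))) ⟩
  x * (1ℚ + fromℕ (count (p ∘ suc)))                    ≡⟨ *-distribˡ-+ x 1ℚ _ ⟩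
  x * 1ℚ + x * fromℕ (count (p ∘ suc))                  ≡⟨ cong (_+ x * fromℕ (count (p ∘ suc))) (*-identityʳ x) ⟩
  x + x * fromℕ (count (p ∘ suc))                       ≤⟨ +-mono-≤ (x≤r₀ tt)
                                                           (*-count≤sumF (p ∘ suc) (r ∘ suc) x (bound ∘ suc)) ⟩
  fromℕ (r zero) + fromℕ (sumF (r ∘ suc))               ≡⟨ fromℕ-+ (r zero) _ ⟨
  fromℕ (sumF r)                                        ∎
  where open ≤-Reasoning

allB-sound : ∀ {k} {p : Fin k → Bool} → T (allB p) → ∀ i → T (p i)
allB-sound {ℕ.suc k} {p} all-p zero    = proj₁ (Equivalence.to T-∧ all-p)
allB-sound {ℕ.suc k} {p} all-p (suc i) = allB-sound {p = p ∘ suc} (proj₂ (Equivalence.to T-∧ all-p)) i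

allB-witness : ∀ {k} (p : Fin k → Bool) → T (not (allB p)) → ∃[ i ] T (not (p i))
allB-witness {ℕ.suc k} p ¬all with p zero in p₀
... | false = zero , subst (T ∘ not) (sym p₀) tt
... | true with allB-witness (p ∘ suc) ¬all
...   | i , ¬pi = suc i , ¬pi

agreeOn-sound : ∀ {n} {S : Subset n} {f g : Fin n → Bool} →
  T (agreeOn S f g) → ∀ {i} → i ∈ S → f i ≡ g i
agreeOn-sound {S = S} {f} {g} agree {i} i∈S with i ∈? S | allB-sound agree i
... | yes _   | fi==gi = does-sound (f i ≟ᵇ g i) fi==gi
... | no i∉S  | _      = contradiction i∈S i∉S

agreeOn-refute : ∀ {n} {S : Subset n} {f g : Fin n → Bool} {i} →
  i ∈ S → f i ≢ g i → T (not (agreeOn S f g))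
agreeOn-refute {S = S} {f} {g} i∈S fi≢gi with agreeOn S f g | agreeOn-sound {S = S} {f} {g}
... | true  | sound = fi≢gi (sound tt i∈S)
... | false | _     = tt

agreeOn-witness : ∀ {n} {S : Subset n} {f g : Fin n → Bool} →
  T (not (agreeOn S f g)) → ∃[ i ] i ∈ S × f i ≢ g i
agreeOn-witness {S = S} {f} {g} disagree with allB-witness _ disagree
... | i , ¬agree-i with i ∈? S
...   | yes i∈S = i , i∈S , T-not⇒¬T ¬agree-i ∘ does-complete (f i ≟ᵇ g i)
...   | no _    = ⊥-elim ¬agree-i

module _ {m n} (V : Fin m → Subset n) (Adj : Fin m → Fin m → Bool) (F : Assignment m n) where

  acceptances rejections : Fin m → ℕ
  acceptances u = count (λ v → Adj u v ∧ agreeOn (V u ∩ V v) (F u) (F v))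
  rejections  u = count (λ v → Adj u v ∧ not (agreeOn (V u ∩ V v) (F u) (F v)))

  acceptances+rejections≡edges : ∀ {d} → IsRegular Adj d →
    sumF acceptances ℕ.+ sumF rejections ≡ m ℕ.* d
  acceptances+rejections≡edges {d} regular = begin
    sumF acceptances ℕ.+ sumF rejections          ≡⟨ sumF-+ acceptances rejections ⟨
    sumF (λ u → acceptances u ℕ.+ rejections u)   ≡⟨ sumF-const _ d (λ u →
                                                       trans (count-split (Adj u) _) (regular u)) ⟩
    m ℕ.* d                                       ∎
    where open ≡-Reasoning

  rejection-rate : ∀ d .{{_ : NonZero m}} .{{_ : NonZero d}} → IsRegular Adj d → ∀ ε →
    acceptProb V Adj d F ≡ 1ℚ - ε → ε * fromℕ (m ℕ.* d) ≡ fromℕ (sumF rejections)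
  rejection-rate d regular ε accept = begin
    ε * E                                     ≡⟨ solve 2 (λ e x → e :* x := x :- (con 1ℚ :- e) :* x) refl ε E ⟩
    E - (1ℚ - ε) * E                          ≡⟨ cong (λ α → E - α * E) accept ⟨
    E - acceptProb V Adj d F * E              ≡⟨ cong (E -_) (n/d*d≡n (sumF acceptances) (m ℕ.* d) {{ℕₚ.m*n≢0 m d}}) ⟩
    E - A                                     ≡⟨ cong (λ e → fromℕ e - A) (acceptances+rejections≡edges regular) ⟨
    fromℕ (sumF acceptances ℕ.+ sumF rejections) - A
                                              ≡⟨ cong (_- A) (fromℕ-+ (sumF acceptances) (sumF rejections)) ⟩
    A + R - A                                 ≡⟨ solve 2 (λ x y → x :+ y :- x := y) refl A R ⟩
    R                                         ∎
    where
    open ≡-Reasoning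
    open +-*-Solver
    E = fromℕ (m ℕ.* d)
    A = fromℕ (sumF acceptances)
    R = fromℕ (sumF rejections)

  disagreements : (Fin n → Bool) → ℕ
  disagreements a = count (λ u → not (agreeOn (V u) (F u) (DP V a u)))

  majority-half : ∀ {a : Fin n → Bool} → IsMajority V F a → ∀ i →
    count (λ v → does (i ∈? V v)) ℕ.≤ 2 ℕ.* count (λ v → does (i ∈? V v) ∧ (F v i == a i))
  majority-half {a} majority i = begin
    count member                       ≡⟨ count-split member agrees ⟨
    count (λ v → member v ∧ agrees v) ℕ.+ count (λ v → member v ∧ not (agrees v))
                                       ≤⟨ ℕₚ.+-monoʳ-≤ (count (λ v → member v ∧ agrees v)) (majority i) ⟩
    count (λ v → member v ∧ agrees v) ℕ.+ count (λ v → member v ∧ agrees v)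
                                       ≡⟨ cong (count (λ v → member v ∧ agrees v) ℕ.+_) (ℕₚ.+-identityʳ _) ⟨
    2 ℕ.* count (λ v → member v ∧ agrees v) ∎
    where
    open ℕₚ.≤-Reasoning
    member agrees : Fin m → Bool
    member v = does (i ∈? V v)
    agrees v = F v i == a i

  agreeing-members-reject : InducedCliques V Adj → ∀ {a : Fin n → Bool} {u i} → i ∈ V u → F u i ≢ a i →
    ∀ v → T (does (i ∈? V v) ∧ (F v i == a i)) →
    T (Adj u v ∧ not (agreeOn (V u ∩ V v) (F u) (F v)))
  agreeing-members-reject cliques {a} {u} {i} i∈u Fu≢a v member-agrees =
    Equivalence.from T-∧ (subst T (sym (cliques i u v i∈u i∈v)) tt ,
                          agreeOn-refute {f = F u} {F v} (x∈p∩q⁺ (i∈u , i∈v)) (λ Fu≡Fv → Fu≢a (trans Fu≡Fv Fv≡a)))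
    where
    i∈v  = does-sound (i ∈? V v) (proj₁ (Equivalence.to T-∧ member-agrees))
    Fv≡a = does-sound (F v i ≟ᵇ a i) (proj₂ (Equivalence.to T-∧ member-agrees))

  neighbours-containing≤2*rejections : InducedCliques V Adj → ∀ {a : Fin n → Bool} → IsMajority V F a →
    ∀ {u i} → i ∈ V u → F u i ≢ a i →
    count (λ v → Adj u v ∧ does (i ∈? V v)) ℕ.≤ 2 ℕ.* rejections u
  neighbours-containing≤2*rejections cliques {a} majority {u} {i} i∈u Fu≢a = begin
    count (λ v → Adj u v ∧ does (i ∈? V v))
      ≤⟨ count-mono _ (λ v → does (i ∈? V v)) (λ v → proj₂ ∘ Equivalence.to T-∧) ⟩
    count (λ v → does (i ∈? V v))
      ≤⟨ majority-half majority i ⟩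
    2 ℕ.* count (λ v → does (i ∈? V v) ∧ (F v i == a i))
      ≤⟨ ℕₚ.*-monoʳ-≤ 2 (count-mono _ _ (agreeing-members-reject cliques {a} i∈u Fu≢a)) ⟩
    2 ℕ.* rejections u ∎
    where open ℕₚ.≤-Reasoning

  disagreement⇒rejections : InducedCliques V Adj → ∀ {a : Fin n → Bool} → IsMajority V F a →
    ∀ d .{{_ : NonZero d}} c → (∀ u i → i ∈ V u → c ≤ neighbourProb V Adj d u i) →
    ∀ u → T (not (agreeOn (V u) (F u) (DP V a u))) → c * fromℕ d ≤ fromℕ (2 ℕ.* rejections u)
  disagreement⇒rejections cliques majority d c neighbourProb≥c u disagree
    with agreeOn-witness disagree
  ... | i , i∈u , Fu≢a = begin
    c * fromℕ d                                        ≤⟨ *-monoʳ-≤-nonNeg (fromℕ d) {{fromℕ-nonNeg d}}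
                                                            (neighbourProb≥c u i i∈u) ⟩
    neighbourProb V Adj d u i * fromℕ d                 ≡⟨ n/d*d≡n (count (λ v → Adj u v ∧ does (i ∈? V v))) d ⟩
    fromℕ (count (λ v → Adj u v ∧ does (i ∈? V v)))     ≤⟨ fromℕ-mono-≤ (neighbours-containing≤2*rejections
                                                            cliques majority i∈u Fu≢a) ⟩
    fromℕ (2 ℕ.* rejections u)                         ∎
    where open ≤-Reasoning

  disagreements≤2*rejections : InducedCliques V Adj → ∀ {a : Fin n → Bool} → IsMajority V F a →
    ∀ d .{{_ : NonZero d}} c → (∀ u i → i ∈ V u → c ≤ neighbourProb V Adj d u i) →
    c * fromℕ d * fromℕ (disagreements a) ≤ fromℕ 2 * fromℕ (sumF rejections)
  disagreements≤2*rejections cliques majority d c neighbourProb≥c = begin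
    c * fromℕ d * fromℕ (disagreements _)
      ≤⟨ *-count≤sumF _ (λ u → 2 ℕ.* rejections u) (c * fromℕ d)
           (disagreement⇒rejections cliques majority d c neighbourProb≥c) ⟩
    fromℕ (sumF (λ u → 2 ℕ.* rejections u))   ≡⟨ cong fromℕ (*-distribˡ-sumF 2 rejections) ⟩
    fromℕ (2 ℕ.* sumF rejections)             ≡⟨ fromℕ-* 2 (sumF rejections) ⟩
    fromℕ 2 * fromℕ (sumF rejections)         ∎
    where open ≤-Reasoning

lemma5p2 : (n m d : ℕ) .{{_ : NonZero m}} .{{_ : NonZero d}}
    (V : Fin m → Subset n) → Injective _≡_ _≡_ V →
    (Adj : Fin m → Fin m → Bool) → IsUndirected Adj → IsRegular Adj d →
    (ε : ℚ) → 0ℚ ≤ ε → (F : Assignment m n) →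
    InducedCliques V Adj →
    (c : ℚ) → (c>0 : c > 0ℚ) →
    (∀ (u : Fin m) (i : Fin n) → i ∈ V u → c ≤ neighbourProb V Adj d u i) →
    acceptProb V Adj d F ≡ 1ℚ - ε →
    (a : Fin n → Bool) → IsMajority V F a →
    Δ V F (DP V a) ≤ _÷_ ((+ 2 / 1) * ε) c {{>-nonZero c>0}}
lemma5p2 n m d V _ Adj _ regular ε _ F cliques c c>0 neighbourProb≥c accept a majority =
  *≤⇒≤÷ {y = fromℕ 2 * ε} c>0 (*-cancelʳ-≤-pos E {{fromℕ-pos (m ℕ.* d) {{ℕₚ.m*n≢0 m d}}}} (begin
    δ * c * E                                ≡⟨ cong (δ * c *_) (fromℕ-* m d) ⟩
    δ * c * (fromℕ m * fromℕ d)              ≡⟨ solve 4 (λ x y z w → x :* y :* (z :* w) := y :* w :* (x :* z))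
                                                  refl δ c (fromℕ m) (fromℕ d) ⟩
    c * fromℕ d * (δ * fromℕ m)              ≡⟨ cong (c * fromℕ d *_) (n/d*d≡n (disagreements V Adj F a) m) ⟩
    c * fromℕ d * fromℕ (disagreements V Adj F a)
                                             ≤⟨ disagreements≤2*rejections V Adj F cliques majority d c neighbourProb≥c ⟩
    fromℕ 2 * fromℕ (sumF (rejections V Adj F))
                                             ≡⟨ cong (fromℕ 2 *_) (rejection-rate V Adj F d regular ε accept) ⟨
    fromℕ 2 * (ε * E)                        ≡⟨ *-assoc (fromℕ 2) ε E ⟨
    fromℕ 2 * ε * E                          ∎))
  where
  open ≤-Reasoning
  open +-*-Solver
  δ = Δ V F (DP V a)
  E = fromℕ (m ℕ.* d)
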